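{- Let $G=(V,E)$ be a graph and let $S\subseteq V$ be fixed. Consider the integer program \[\min\sum_{v\in V}f_v\quad\text{subject to}\quad \sum_{v\in V}f_v\ge 1;\quad f_w+\sum_{u\in N(w)\setminus\{v\}}f_u\ge f_v\ \ \forall (v,w)\text{ with } v\in V,\ w\in N(v);\quad f_v=0\ \ \forall v\in cl(N[S]);\quad f_v\in\{0,1\}\ \ \forall v\in V.\] If $G$ has a fort $F$ with $F\cap cl(N[S])=\emptyset$, then for every optimal solution $f$ of this program, the set $\{v\in V: f_v=1\}$ is a fort of $G$ disjoint from $cl(N[S])$, and it has minimum cardinality among all forts of $G$ disjoint from $cl(N[S])$.
   Context: All graphs are finite, simple and undirected. $N(v)$ denotes the set of neighbors of $v$, $N[v]=N(v)\cup\{v\}$, $N[S]=\bigcup_{v\in S}N[v]$. A fort of $G$ is a nonempty set $F\subseteq V$ such that no vertex outside $F$ is adjacent to exactly one vertex of $F$. For a set $B$ of blue vertices (others white), the color change rule says that if a blue vertex $u$ has exactly one white neighbor $w$, then $w$ becomes blue; $cl(B)$ is the set of blue vertices obtained by applying this rule until no more changes are possible. (Such a fort disjoint from $cl(N[S])$ is called a violated fort with respect to $S$.) -}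

module Defs where

open import Data.Nat using (ℕ; zero; suc; _+_; _≤_; _≡ᵇ_)
open import Data.Bool using (Bool; true; false; if_then_else_; _∧_; not)
open import Data.Fin using (Fin; zero; suc; _≟_)
open import Data.Fin.Subset using (Subset; _∈_; _∉_; ∣_∣)
open import Data.Vec using (lookup; tabulate)
open import Data.Product using (Σ; ∃; _×_; _,_)
open import Data.Sum using (_⊎_)
open import Relation.Nullary using (¬_; does)
open import Relation.Binary.PropositionalEquality using (_≡_; _≢_)

record Graph (n : ℕ) : Set where
  field
    adj     : Fin n → Fin n → Bool
    symm    : ∀ u v → adj u v ≡ adj v u
    irrefl  : ∀ v → adj v v ≡ false

open Graph public

ΣV : ∀ {n} → (Fin n → ℕ) → ℕ
ΣV {zero}  f = 0
ΣV {suc n} f = f zero + ΣV (λ i → f (suc i))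

nbrsIn : ∀ {n} → Graph n → Subset n → Fin n → ℕ
nbrsIn G F v = ΣV (λ u → if adj G v u ∧ lookup F u then 1 else 0)

IsFort : ∀ {n} → Graph n → Subset n → Set
IsFort G F = (∃ λ v → v ∈ F) × (∀ v → v ∉ F → nbrsIn G F v ≢ 1)

ClosedNbhd : ∀ {n} → Graph n → Subset n → Fin n → Set
ClosedNbhd G S v = v ∈ S ⊎ (∃ λ u → u ∈ S × adj G u v ≡ true)

-- cl(B): the blue set obtained from B by repeatedly applying the colour
-- change rule (least set containing B closed under forcing).
data Cl {n : ℕ} (G : Graph n) (B : Fin n → Set) : Fin n → Set where
  base  : ∀ {v} → B v → Cl G B v
  force : ∀ {u w} → Cl G B u → adj G u w ≡ true →
          (∀ x → adj G u x ≡ true → x ≢ w → Cl G B x) → Cl G B w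

ΣNbrsExcept : ∀ {n} → Graph n → (Fin n → ℕ) → Fin n → Fin n → ℕ
ΣNbrsExcept G f w v = ΣV (λ u → if adj G w u ∧ not (does (u ≟ v)) then f u else 0)

Feasible : ∀ {n} → Graph n → Subset n → (Fin n → ℕ) → Set
Feasible G S f =
    (1 ≤ ΣV f)
  × (∀ v w → adj G v w ≡ true → f v ≤ f w + ΣNbrsExcept G f w v)
  × (∀ v → Cl G (ClosedNbhd G S) v → f v ≡ 0)
  × (∀ v → f v ≡ 0 ⊎ f v ≡ 1)

Optimal : ∀ {n} → Graph n → Subset n → (Fin n → ℕ) → Set
Optimal G S f = Feasible G S f × (∀ g → Feasible G S g → ΣV f ≤ ΣV g)

ViolatedFort : ∀ {n} → Graph n → Subset n → Subset n → Set
ViolatedFort G S F = IsFort G F × (∀ v → v ∈ F → ¬ Cl G (ClosedNbhd G S) v)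

support : ∀ {n} → (Fin n → ℕ) → Subset n
support f = tabulate (λ v → f v ≡ᵇ 1)

-- A 0/1 vector f is the indicator of the set F = {v : f v = 1}.  For an edge vw the
-- constraint  f v ≤ f w + f(N(w) ∖ {v})  fails exactly when v ∈ F, w ∉ F and v is the
-- only neighbour of w in F; so the constraints over all edges say precisely that F is a
-- fort.  The remaining constraints say that F is nonempty and avoids cl(N[S]).  Hence
-- the feasible solutions are exactly the indicators of violated forts, the objective is
-- their cardinality, and an optimal solution is the indicator of a minimum violated fort.
module Submission where

open import Defs
open import Algebra.Properties.CommutativeSemigroup using (x∙yz≈y∙xz)
open import Data.Bool using (true; false; if_then_else_; _∧_; not)
open import Data.Fin using (Fin; zero; suc; _≟_)
open import Data.Fin.Subset using (Subset; ∣_∣; _∈_; _∉_; inside; outside)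
open import Data.Fin.Subset.Properties using (_∈?_)
open import Data.Nat using (ℕ; zero; suc; _+_; _≤_; z≤n; s≤s; _≡ᵇ_)
open import Data.Nat.Properties
  using (≤-trans; m≤m+n; m≤n+m; suc-injective; n≢0⇒n>0; +-commutativeSemigroup; module ≤-Reasoning)
open import Function using (_∘_)
open import Data.Product using (∃; _×_; _,_)
open import Data.Sum using (_⊎_; inj₁; inj₂)
open import Data.Vec using ([]; _∷_; lookup)
open import Data.Vec.Properties using ([]=⇒lookup; lookup⇒[]=; lookup∘tabulate)
open import Relation.Nullary using (does; yes; no; contradiction)
open import Relation.Binary.PropositionalEquality

private
  variable
    n : ℕ

ΣV-cong : {f g : Fin n → ℕ} → f ≗ g → ΣV f ≡ ΣV g
ΣV-cong {zero}  f≗g = refl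
ΣV-cong {suc n} f≗g = cong₂ _+_ (f≗g zero) (ΣV-cong (λ i → f≗g (suc i)))

ΣV-extract : (v : Fin n) (g : Fin n → ℕ) →
             ΣV g ≡ g v + ΣV (λ u → if does (u ≟ v) then 0 else g u)
ΣV-extract zero    g = refl
ΣV-extract (suc v) g = begin
  g zero + ΣV (λ i → g (suc i))
    ≡⟨ cong (g zero +_) (ΣV-extract v (λ i → g (suc i))) ⟩
  g zero + (g (suc v) + _)
    ≡⟨ x∙yz≈y∙xz +-commutativeSemigroup (g zero) (g (suc v)) _ ⟩
  g (suc v) + (g zero + _) ∎
  where open ≡-Reasoning

term≤ΣV : (v : Fin n) (g : Fin n → ℕ) → g v ≤ ΣV g
term≤ΣV zero    g = m≤m+n _ _
term≤ΣV (suc v) g = ≤-trans (term≤ΣV v (λ i → g (suc i))) (m≤n+m _ _)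

positive-term : (g : Fin n → ℕ) → 1 ≤ ΣV g → ∃ λ v → 1 ≤ g v
positive-term {suc n} g 1≤Σg with g zero in eq
... | suc _ = zero , subst (1 ≤_) (sym eq) (s≤s z≤n)
... | zero  with positive-term (λ i → g (suc i)) 1≤Σg
...   | v , 1≤gv = suc v , 1≤gv

indicator : Subset n → Fin n → ℕ
indicator F v = if lookup F v then 1 else 0

module _ {F : Subset n} {v : Fin n} where

  indicator-∈ : v ∈ F → indicator F v ≡ 1
  indicator-∈ v∈F rewrite []=⇒lookup v∈F = refl

  indicator-∉ : v ∉ F → indicator F v ≡ 0
  indicator-∉ v∉F with lookup F v in eq
  ... | true  = contradiction (lookup⇒[]= v F eq) v∉F
  ... | false = refl

indicator-binary : (F : Subset n) (v : Fin n) → indicator F v ≡ 0 ⊎ indicator F v ≡ 1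
indicator-binary F v with lookup F v
... | true  = inj₂ refl
... | false = inj₁ refl

∣∣≡ΣV-indicator : (F : Subset n) → ∣ F ∣ ≡ ΣV (indicator F)
∣∣≡ΣV-indicator []            = refl
∣∣≡ΣV-indicator (inside  ∷ F) = cong suc (∣∣≡ΣV-indicator F)
∣∣≡ΣV-indicator (outside ∷ F) = ∣∣≡ΣV-indicator F

indicator-support : (f : Fin n → ℕ) → (∀ v → f v ≡ 0 ⊎ f v ≡ 1) → indicator (support f) ≗ f
indicator-support f binary v rewrite lookup∘tabulate (λ u → f u ≡ᵇ 1) v
  with f v | binary v
... | _ | inj₁ refl = refl
... | _ | inj₂ refl = refl

nonempty⇒1≤ΣV-indicator : {F : Subset n} → (∃ λ v → v ∈ F) → 1 ≤ ΣV (indicator F)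
nonempty⇒1≤ΣV-indicator {F = F} (v , v∈F) =
  subst (_≤ ΣV (indicator F)) (indicator-∈ v∈F) (term≤ΣV v (indicator F))

1≤ΣV-indicator⇒nonempty : {F : Subset n} → 1 ≤ ΣV (indicator F) → ∃ λ v → v ∈ F
1≤ΣV-indicator⇒nonempty {F = F} 1≤Σ with positive-term (indicator F) 1≤Σ
... | v , 1≤χv with v ∈? F
...   | yes v∈F = v , v∈F
...   | no  v∉F = contradiction (subst (1 ≤_) (indicator-∉ v∉F) 1≤χv) λ ()

module _ (G : Graph n) where

  FortCondition : Subset n → Set
  FortCondition F = ∀ w → w ∉ F → nbrsIn G F w ≢ 1

  EdgeConstraints : (Fin n → ℕ) → Set
  EdgeConstraints f = ∀ v w → adj G v w ≡ true → f v ≤ f w + ΣNbrsExcept G f w v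

  nbrsIn-extract : (F : Subset n) (w v : Fin n) →
    nbrsIn G F w ≡ (if adj G w v ∧ lookup F v then 1 else 0) + ΣNbrsExcept G (indicator F) w v
  nbrsIn-extract F w v =
    trans (ΣV-extract v _) (cong ((if adj G w v ∧ lookup F v then 1 else 0) +_) (ΣV-cong rest))
    where
    rest : ∀ u → (if does (u ≟ v) then 0 else (if adj G w u ∧ lookup F u then 1 else 0))
               ≡ (if adj G w u ∧ not (does (u ≟ v)) then indicator F u else 0)
    rest u with does (u ≟ v) | adj G w u
    ... | true  | true  = refl
    ... | true  | false = refl
    ... | false | true  = refl
    ... | false | false = refl

  nbrsIn-from-neighbour : {F : Subset n} {v w : Fin n} → adj G v w ≡ true → v ∈ F →
    nbrsIn G F w ≡ 1 + ΣNbrsExcept G (indicator F) w v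
  nbrsIn-from-neighbour {F} {v} {w} vw v∈F
    rewrite nbrsIn-extract F w v | symm G w v | vw | []=⇒lookup v∈F = refl

  neighbour-in : (F : Subset n) (w : Fin n) → 1 ≤ nbrsIn G F w →
                 ∃ λ v → adj G v w ≡ true × v ∈ F
  neighbour-in F w 1≤nbrs with positive-term _ 1≤nbrs
  ... | v , 1≤term with adj G w v in wv | lookup F v in Fv
  ...   | true  | true  = v , trans (symm G v w) wv , lookup⇒[]= v F Fv
  ...   | true  | false = contradiction 1≤term λ ()
  ...   | false | _     = contradiction 1≤term λ ()

  fortCondition⇒edgeConstraints : {F : Subset n} → FortCondition F → EdgeConstraints (indicator F)
  fortCondition⇒edgeConstraints {F} fort v w vw with v ∈? F | w ∈? F
  ... | no v∉F | _ rewrite indicator-∉ v∉F = z≤n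
  ... | yes v∈F | yes w∈F rewrite indicator-∈ v∈F | indicator-∈ w∈F = s≤s z≤n
  ... | yes v∈F | no w∉F rewrite indicator-∈ v∈F | indicator-∉ w∉F =
    n≢0⇒n>0 (λ rest≡0 → fort w w∉F (trans (nbrsIn-from-neighbour vw v∈F) (cong suc rest≡0)))

  edgeConstraints⇒fortCondition : {F : Subset n} → EdgeConstraints (indicator F) → FortCondition F
  edgeConstraints⇒fortCondition {F} edges w w∉F nbrs≡1
    with neighbour-in F w (subst (1 ≤_) (sym nbrs≡1) (s≤s z≤n))
  ... | v , vw , v∈F = contradiction 1≤0 λ ()
    where
    open ≤-Reasoning
    rest≡0 : ΣNbrsExcept G (indicator F) w v ≡ 0
    rest≡0 = suc-injective (trans (sym (nbrsIn-from-neighbour vw v∈F)) nbrs≡1)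
    1≤0 : 1 ≤ 0
    1≤0 = begin
      1                                               ≡⟨ indicator-∈ v∈F ⟨
      indicator F v                                   ≤⟨ edges v w vw ⟩
      indicator F w + ΣNbrsExcept G (indicator F) w v ≡⟨ cong₂ _+_ (indicator-∉ w∉F) rest≡0 ⟩
      0                                               ∎

Feasible-resp-≗ : (G : Graph n) (S : Subset n) {f g : Fin n → ℕ} →
                  f ≗ g → Feasible G S f → Feasible G S g
Feasible-resp-≗ G S {f} {g} f≗g (total , edges , closure , binary) =
    subst (1 ≤_) (ΣV-cong f≗g) total
  , (λ v w vw → subst₂ _≤_ (f≗g v) (cong₂ _+_ (f≗g w) (rest≗ w v)) (edges v w vw))
  , (λ v c → trans (sym (f≗g v)) (closure v c))
  , (λ v → subst (λ t → t ≡ 0 ⊎ t ≡ 1) (f≗g v) (binary v))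
  where
  rest≗ : ∀ w v → ΣNbrsExcept G f w v ≡ ΣNbrsExcept G g w v
  rest≗ w v = ΣV-cong λ u → cong (λ t → if adj G w u ∧ not (does (u ≟ v)) then t else 0) (f≗g u)

module _ (G : Graph n) (S : Subset n) {F : Subset n} where

  violatedFort⇒feasible-indicator : ViolatedFort G S F → Feasible G S (indicator F)
  violatedFort⇒feasible-indicator ((nonempty , fort) , avoids) =
      nonempty⇒1≤ΣV-indicator nonempty
    , fortCondition⇒edgeConstraints G fort
    , (λ v c → indicator-∉ λ v∈F → avoids v v∈F c)
    , indicator-binary F

  feasible-indicator⇒violatedFort : Feasible G S (indicator F) → ViolatedFort G S F
  feasible-indicator⇒violatedFort (total , edges , closure , _) =
      (1≤ΣV-indicator⇒nonempty total , edgeConstraints⇒fortCondition G edges)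
    , λ v v∈F c → contradiction (trans (sym (indicator-∈ v∈F)) (closure v c)) λ ()

-- The assumed violated fort only guarantees that an optimal solution exists, which is
-- given here anyway.
theorem4p5 : ∀ {n} (G : Graph n) (S : Subset n) →
    (∃ λ F → ViolatedFort G S F) →
    ∀ (f : Fin n → ℕ) → Optimal G S f →
    ViolatedFort G S (support f) × (∀ F → ViolatedFort G S F → ∣ support f ∣ ≤ ∣ F ∣)
theorem4p5 G S _ f (feasible@(_ , _ , _ , binary) , optimal) =
  feasible-indicator⇒violatedFort G S (Feasible-resp-≗ G S (sym ∘ χ≗f) feasible) , minimum
  where
  χ≗f : indicator (support f) ≗ f
  χ≗f = indicator-support f binary

  minimum : ∀ F → ViolatedFort G S F → ∣ support f ∣ ≤ ∣ F ∣
  minimum F violated = begin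
    ∣ support f ∣              ≡⟨ ∣∣≡ΣV-indicator (support f) ⟩
    ΣV (indicator (support f)) ≡⟨ ΣV-cong χ≗f ⟩
    ΣV f                       ≤⟨ optimal _ (violatedFort⇒feasible-indicator G S violated) ⟩
    ΣV (indicator F)           ≡⟨ ∣∣≡ΣV-indicator F ⟨
    ∣ F ∣                      ∎
    where open ≤-Reasoning
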